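{- The axiom system $\mathcal{E}_v$ is sound modulo verdict equivalence: for all $m,n\in Mon_F$, if $\mathcal{E}_v\vdash m=n$ then $m\simeq n$.
   Context: Fix a set $Act$ of visible actions, a symbol $\tau\notin Act$, and a countably infinite set $Var$ of variables disjoint from $Act\cup\{\tau\}$. Monitors $Mon_F$: $m,n ::= v \mid a.m \mid m+n \mid x$ ($a\in Act$, $x\in Var$), verdicts $v ::= \mathit{end}\mid \mathit{yes}\mid \mathit{no}$. Closed monitors contain no variables; (closed) substitutions map variables to (closed) monitors. Transitions: for $\alpha\in Act\cup\{\tau\}$, $\xrightarrow{\alpha}$ is the least relation with $a.m\xrightarrow{a}m$; if $m\xrightarrow{\alpha}m'$ then $m+n\xrightarrow{\alpha}m'$ and $n+m\xrightarrow{\alpha}m'$; and $v\xrightarrow{\alpha}v$ for every verdict $v$ and every $\alpha$. Weak transitions: $m\xRightarrow{\varepsilon}m'$ iff $m(\xrightarrow{\tau})^*m'$; $m\xRightarrow{a}m'$ iff $m\xRightarrow{\varepsilon}m_1\xrightarrow{a}m_2\xRightarrow{\varepsilon}m'$; $m\xRightarrow{as'}m'$ ($s'\neq\varepsilon$) iff $m\xRightarrow{a}m_1\xRightarrow{s'}m'$. $L_a(m)=\{s\mid m\xRightarrow{s}\mathit{yes}\}$, $L_r(m)=\{s\mid m\xRightarrow{s}\mathit{no}\}$. Closed $m\simeq n$ iff $L_a(m)=L_a(n)$ and $L_r(m)=L_r(n)$; open $m\simeq n$ iff $\sigma(m)\simeq\sigma(n)$ for all closed substitutions $\sigma$. $\mathcal{E}\vdash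 m=n$: derivability by reflexivity, symmetry, transitivity, substitutivity and congruence for $a.\_$ and $+$. $\mathcal{E}_v$: (A1) $x+y=y+x$; (A2) $x+(y+z)=(x+y)+z$; (A3) $x+x=x$; (A4) $x+\mathit{end}=x$; for each $a\in Act$: $(E_a)$ $a.\mathit{end}=\mathit{end}$; $(Y_a)$ $\mathit{yes}=\mathit{yes}+a.\mathit{yes}$; $(N_a)$ $\mathit{no}=\mathit{no}+a.\mathit{no}$; $(D_a)$ $a.(x+y)=a.x+a.y$. -}

module Defs where

open import Data.Nat using (ℕ)
open import Data.List using (List; []; _∷_)
open import Data.Product using (_×_)

Var : Set
Var = ℕ

module Monitors (Act : Set) where

  data Verdict : Set where
    end yes no : Verdict

  data Mon : Set where
    verd : Verdict → Mon
    _∙_  : Act → Mon → Mon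
    _⊕_  : Mon → Mon → Mon
    var  : Var → Mon

  data Label : Set where
    act : Act → Label
    τ   : Label

  data _—[_]→_ : Mon → Label → Mon → Set where
    prefix : ∀ {a m} → (a ∙ m) —[ act a ]→ m
    sumL   : ∀ {m n α m'} → m —[ α ]→ m' → (m ⊕ n) —[ α ]→ m'
    sumR   : ∀ {m n α m'} → m —[ α ]→ m' → (n ⊕ m) —[ α ]→ m'
    verdT  : ∀ {v α} → verd v —[ α ]→ verd v

  data _⇒ε_ : Mon → Mon → Set where
    ε-refl : ∀ {m} → m ⇒ε m
    ε-step : ∀ {m m₁ m'} → m —[ τ ]→ m₁ → m₁ ⇒ε m' → m ⇒ε m'

  data _=[_]⇒_ : Mon → Act → Mon → Set where
    weak : ∀ {m m₁ m₂ m' a} → m ⇒ε m₁ → m₁ —[ act a ]→ m₂ → m₂ ⇒ε m' → m =[ a ]⇒ m'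

  data _=[_]⇒*_ : Mon → List Act → Mon → Set where
    tr-nil  : ∀ {m m'} → m ⇒ε m' → m =[ [] ]⇒* m'
    tr-cons : ∀ {m m₁ m' a s} → m =[ a ]⇒ m₁ → m₁ =[ s ]⇒* m' → m =[ a ∷ s ]⇒* m'

  Lₐ : Mon → List Act → Set
  Lₐ m s = m =[ s ]⇒* verd yes

  Lᵣ : Mon → List Act → Set
  Lᵣ m s = m =[ s ]⇒* verd no

  data Closed : Mon → Set where
    c-verd : ∀ {v} → Closed (verd v)
    c-pre  : ∀ {a m} → Closed m → Closed (a ∙ m)
    c-sum  : ∀ {m n} → Closed m → Closed n → Closed (m ⊕ n)

  _≃c_ : Mon → Mon → Set
  m ≃c n = (∀ s → (Lₐ m s → Lₐ n s) × (Lₐ n s → Lₐ m s))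
         × (∀ s → (Lᵣ m s → Lᵣ n s) × (Lᵣ n s → Lᵣ m s))

  Subst : Set
  Subst = Var → Mon

  _[_] : Mon → Subst → Mon
  verd v [ σ ] = verd v
  (a ∙ m) [ σ ] = a ∙ (m [ σ ])
  (m ⊕ n) [ σ ] = (m [ σ ]) ⊕ (n [ σ ])
  var x [ σ ] = σ x

  ClosedSubst : Subst → Set
  ClosedSubst σ = ∀ x → Closed (σ x)

  _≃_ : Mon → Mon → Set
  m ≃ n = ∀ σ → ClosedSubst σ → (m [ σ ]) ≃c (n [ σ ])

  x y z : Mon
  x = var 0
  y = var 1
  z = var 2

  data Axiom : Mon → Mon → Set where
    A1 : Axiom (x ⊕ y) (y ⊕ x)
    A2 : Axiom (x ⊕ (y ⊕ z)) ((x ⊕ y) ⊕ z)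
    A3 : Axiom (x ⊕ x) x
    A4 : Axiom (x ⊕ verd end) x
    Ea : ∀ a → Axiom (a ∙ verd end) (verd end)
    Ya : ∀ a → Axiom (verd yes) (verd yes ⊕ (a ∙ verd yes))
    Na : ∀ a → Axiom (verd no) (verd no ⊕ (a ∙ verd no))
    Da : ∀ a → Axiom (a ∙ (x ⊕ y)) ((a ∙ x) ⊕ (a ∙ y))

  infix 4 ⊢_≈_
  data ⊢_≈_ : Mon → Mon → Set where
    ax    : ∀ {m n} → Axiom m n → ⊢ m ≈ n
    refl  : ∀ {m} → ⊢ m ≈ m
    sym   : ∀ {m n} → ⊢ m ≈ n → ⊢ n ≈ m
    trans : ∀ {m n k} → ⊢ m ≈ n → ⊢ n ≈ k → ⊢ m ≈ k
    subst : ∀ {m n} (σ : Subst) → ⊢ m ≈ n → ⊢ (m [ σ ]) ≈ (n [ σ ])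
    cong∙ : ∀ {m n} (a : Act) → ⊢ m ≈ n → ⊢ (a ∙ m) ≈ (a ∙ n)
    cong⊕ : ∀ {m m' n n'} → ⊢ m ≈ m' → ⊢ n ≈ n' → ⊢ (m ⊕ n) ≈ (m' ⊕ n')

-- Whether a monitor reaches a verdict w along a trace s is decided by its syntax alone:
-- a verdict reaches only itself, along every trace; a prefix a.m must consume a and
-- hand over to m; a sum reaches w iff a summand does (τ-steps are verdict self-loops,
-- so they never change the trace).  Soundness then amounts to every axiom and rule
-- preserving "reaches yes / no along the same traces", which holds for arbitrary
-- substitutions, closed or not, since a variable reaches nothing.
module Submission where

open import Defs
open import Data.List using (List; []; _∷_)
open import Data.Product using (_×_; _,_; proj₂)
open import Data.Product.Algebra using (×-distribˡ-⊎)
open import Data.Product.Function.NonDependent.Propositional using (_×-⇔_)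
open import Data.Sum using (_⊎_; inj₁; inj₂; reduce; fromInj₁)
open import Data.Sum.Algebra using (⊎-comm; ⊎-assoc)
open import Data.Sum.Function.Propositional using (_⊎-⇔_)
open import Data.Empty using (⊥; ⊥-elim)
open import Function using (_∘_)
open import Function.Bundles using (_⇔_; mk⇔; Equivalence)
open import Function.Construct.Identity using (⇔-id)
open import Function.Construct.Symmetry using (⇔-sym)
open import Function.Construct.Composition using (_⇔-∘_)
open import Function.Properties.Inverse using (↔⇒⇔)
open import Relation.Nullary using (¬_)
open import Relation.Binary.PropositionalEquality as ≡ using (_≡_; _≢_)

module Soundness (Act : Set) where
  open Monitors Act

  Reaches : Verdict → Mon → List Act → Set
  Reaches w (verd v) s = v ≡ w
  Reaches w (a ∙ m) [] = ⊥
  Reaches w (a ∙ m) (b ∷ s) = a ≡ b × Reaches w m s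
  Reaches w (m ⊕ n) s = Reaches w m s ⊎ Reaches w n s
  Reaches w (var x) s = ⊥

  reaches-τ-pred : ∀ {w m m' s} → m —[ τ ]→ m' → Reaches w m' s → Reaches w m s
  reaches-τ-pred (sumL st) r = inj₁ (reaches-τ-pred st r)
  reaches-τ-pred (sumR st) r = inj₂ (reaches-τ-pred st r)
  reaches-τ-pred verdT r = r

  reaches-ε-pred : ∀ {w m m' s} → m ⇒ε m' → Reaches w m' s → Reaches w m s
  reaches-ε-pred ε-refl r = r
  reaches-ε-pred (ε-step st e) r = reaches-τ-pred st (reaches-ε-pred e r)

  reaches-act-pred : ∀ {w m m' a s} → m —[ act a ]→ m' → Reaches w m' s → Reaches w m (a ∷ s)
  reaches-act-pred prefix r = ≡.refl , r
  reaches-act-pred (sumL st) r = inj₁ (reaches-act-pred st r)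
  reaches-act-pred (sumR st) r = inj₂ (reaches-act-pred st r)
  reaches-act-pred verdT r = r

  trace⇒reaches : ∀ {w m s} → m =[ s ]⇒* verd w → Reaches w m s
  trace⇒reaches (tr-nil e) = reaches-ε-pred e ≡.refl
  trace⇒reaches (tr-cons (weak e₁ st e₂) t) =
    reaches-ε-pred e₁ (reaches-act-pred st (reaches-ε-pred e₂ (trace⇒reaches t)))

  verd-trace : ∀ v s → verd v =[ s ]⇒* verd v
  verd-trace v [] = tr-nil ε-refl
  verd-trace v (a ∷ s) = tr-cons (weak ε-refl verdT ε-refl) (verd-trace v s)

  SimulatesStep : Mon → Mon → Set
  SimulatesStep k m = ∀ {α m'} → m —[ α ]→ m' → k —[ α ]→ m'

  simulates-ε : ∀ {k m w} → SimulatesStep k m → m ⇒ε verd w → k ⇒ε verd w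
  simulates-ε sim ε-refl = ε-step (sim verdT) ε-refl
  simulates-ε sim (ε-step st e) = ε-step (sim st) e

  simulates-weak : ∀ {k m a m'} → SimulatesStep k m → m =[ a ]⇒ m' → k =[ a ]⇒ m'
  simulates-weak sim (weak ε-refl st e) = weak ε-refl (sim st) e
  simulates-weak sim (weak (ε-step st e₁) st' e₂) = weak (ε-step (sim st) e₁) st' e₂

  simulates-trace : ∀ {k m w s} → SimulatesStep k m → m =[ s ]⇒* verd w → k =[ s ]⇒* verd w
  simulates-trace sim (tr-nil e) = tr-nil (simulates-ε sim e)
  simulates-trace sim (tr-cons t ts) = tr-cons (simulates-weak sim t) ts

  reaches⇒trace : ∀ {w} m s → Reaches w m s → m =[ s ]⇒* verd w
  reaches⇒trace (verd v) s ≡.refl = verd-trace v s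
  reaches⇒trace (a ∙ m) (.a ∷ s) (≡.refl , r) =
    tr-cons (weak ε-refl prefix ε-refl) (reaches⇒trace m s r)
  reaches⇒trace (m ⊕ n) s (inj₁ r) = simulates-trace sumL (reaches⇒trace m s r)
  reaches⇒trace (m ⊕ n) s (inj₂ r) = simulates-trace sumR (reaches⇒trace n s r)

  trace⇔reaches : ∀ {w} m s → (m =[ s ]⇒* verd w) ⇔ Reaches w m s
  trace⇔reaches m s = mk⇔ trace⇒reaches (reaches⇒trace m s)

  infix 4 _≅_
  _≅_ : Mon → Mon → Set
  m ≅ n = ∀ {w} → w ≢ end → ∀ s → Reaches w m s ⇔ Reaches w n s

  ≅-refl : ∀ {m} → m ≅ m
  ≅-refl _ _ = ⇔-id _

  ≅-sym : ∀ {m n} → m ≅ n → n ≅ m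
  ≅-sym m≅n w≢end s = ⇔-sym (m≅n w≢end s)

  ≅-trans : ∀ {m n k} → m ≅ n → n ≅ k → m ≅ k
  ≅-trans m≅n n≅k w≢end s = n≅k w≢end s ⇔-∘ m≅n w≢end s

  ∙-cong : ∀ {m n} a → m ≅ n → a ∙ m ≅ a ∙ n
  ∙-cong a m≅n w≢end [] = ⇔-id ⊥
  ∙-cong a m≅n w≢end (b ∷ s) = ⇔-id (a ≡ b) ×-⇔ m≅n w≢end s

  ⊕-cong : ∀ {m m' n n'} → m ≅ m' → n ≅ n' → m ⊕ n ≅ m' ⊕ n'
  ⊕-cong m≅m' n≅n' w≢end s = m≅m' w≢end s ⊎-⇔ n≅n' w≢end s

  ⊕-comm : ∀ m n → m ⊕ n ≅ n ⊕ m
  ⊕-comm m n _ _ = ↔⇒⇔ (⊎-comm _ _)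

  ⊕-assoc : ∀ m n k → m ⊕ (n ⊕ k) ≅ (m ⊕ n) ⊕ k
  ⊕-assoc m n k _ _ = ⇔-sym (↔⇒⇔ (⊎-assoc _ _ _ _))

  ⊕-idem : ∀ m → m ⊕ m ≅ m
  ⊕-idem m _ _ = mk⇔ reduce inj₁

  end-unreachable : ∀ {w} → w ≢ end → ∀ s → ¬ Reaches w (verd end) s
  end-unreachable w≢end s = w≢end ∘ ≡.sym

  ⊕-identityʳ : ∀ m → m ⊕ verd end ≅ m
  ⊕-identityʳ m w≢end s = mk⇔ (fromInj₁ (⊥-elim ∘ end-unreachable w≢end s)) inj₁

  ∙-end : ∀ a → a ∙ verd end ≅ verd end
  ∙-end a w≢end [] = mk⇔ (λ ()) (⊥-elim ∘ end-unreachable w≢end [])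
  ∙-end a w≢end (b ∷ s) =
    mk⇔ (⊥-elim ∘ end-unreachable w≢end s ∘ proj₂) (⊥-elim ∘ end-unreachable w≢end (b ∷ s))

  verd-absorbs-∙ : ∀ v a → verd v ≅ verd v ⊕ (a ∙ verd v)
  verd-absorbs-∙ v a _ [] = mk⇔ inj₁ (fromInj₁ λ ())
  verd-absorbs-∙ v a _ (b ∷ s) = mk⇔ inj₁ (fromInj₁ proj₂)

  ∙-distrib-⊕ : ∀ a m n → a ∙ (m ⊕ n) ≅ (a ∙ m) ⊕ (a ∙ n)
  ∙-distrib-⊕ a m n _ [] = mk⇔ (λ ()) λ { (inj₁ ()) ; (inj₂ ()) }
  ∙-distrib-⊕ a m n _ (b ∷ s) = ↔⇒⇔ (×-distribˡ-⊎ _ _ _ _)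

  axiom-sound : ∀ {m n} → Axiom m n → ∀ σ → (m [ σ ]) ≅ (n [ σ ])
  axiom-sound A1 σ = ⊕-comm _ _
  axiom-sound A2 σ = ⊕-assoc _ _ _
  axiom-sound A3 σ = ⊕-idem _
  axiom-sound A4 σ = ⊕-identityʳ _
  axiom-sound (Ea a) σ = ∙-end a
  axiom-sound (Ya a) σ = verd-absorbs-∙ yes a
  axiom-sound (Na a) σ = verd-absorbs-∙ no a
  axiom-sound (Da a) σ = ∙-distrib-⊕ a _ _

  []-∘ : ∀ m σ σ' → (m [ σ ]) [ σ' ] ≡ m [ (λ v → σ v [ σ' ]) ]
  []-∘ (verd v) σ σ' = ≡.refl
  []-∘ (a ∙ m) σ σ' = ≡.cong (a ∙_) ([]-∘ m σ σ')
  []-∘ (m ⊕ n) σ σ' = ≡.cong₂ _⊕_ ([]-∘ m σ σ') ([]-∘ n σ σ')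
  []-∘ (var x) σ σ' = ≡.refl

  derivable-sound : ∀ {m n} → ⊢ m ≈ n → ∀ σ → (m [ σ ]) ≅ (n [ σ ])
  derivable-sound (ax axiom) σ = axiom-sound axiom σ
  derivable-sound refl σ = ≅-refl
  derivable-sound (sym p) σ = ≅-sym (derivable-sound p σ)
  derivable-sound (trans p q) σ = ≅-trans (derivable-sound p σ) (derivable-sound q σ)
  derivable-sound (subst {m} {n} σ₀ p) σ
    rewrite []-∘ m σ₀ σ | []-∘ n σ₀ σ = derivable-sound p (λ v → σ₀ v [ σ ])
  derivable-sound (cong∙ a p) σ = ∙-cong a (derivable-sound p σ)
  derivable-sound (cong⊕ p q) σ = ⊕-cong (derivable-sound p σ) (derivable-sound q σ)

  ≅⇒same-trace : ∀ {m n w} → w ≢ end → m ≅ n → ∀ s → (m =[ s ]⇒* verd w) ⇔ (n =[ s ]⇒* verd w)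
  ≅⇒same-trace {m} {n} w≢end m≅n s =
    ⇔-sym (trace⇔reaches n s) ⇔-∘ (m≅n w≢end s ⇔-∘ trace⇔reaches m s)

  ⇔⇒both-ways : ∀ {A B : Set} → A ⇔ B → (A → B) × (B → A)
  ⇔⇒both-ways A⇔B = Equivalence.to A⇔B , Equivalence.from A⇔B

  ≅⇒≃c : ∀ {m n} → m ≅ n → m ≃c n
  ≅⇒≃c m≅n = (⇔⇒both-ways ∘ ≅⇒same-trace (λ ()) m≅n) , (⇔⇒both-ways ∘ ≅⇒same-trace (λ ()) m≅n)

theorem1 : (Act : Set) → let open Monitors Act in
             (m n : Mon) → ⊢ m ≈ n → m ≃ n
theorem1 Act m n m≈n σ _ = ≅⇒≃c (derivable-sound m≈n σ)
  where open Soundness Act
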